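{- Let $G^{C_4}$ be a $4$-base-module with $C_4=v_1v_2v_3v_4v_1$, let $f$ be a module-colouring of $G^{C_4}$ with $f(v_1)=f(v_3)=1$, $f(v_2)=f(v_4)=2$ and $P_{2i}^f(v_2,v_4)\neq\emptyset$ for $i=3,4$, and let $W_4=u$-$u_1u_2u_3u_2'u_1$ be a contractible $4$-wheel with respect to $f$. Let $H^{C_4}$ be obtained from $G^{C_4}$ by the contracting $4$-wheel operation on $W_4$ with contracted vertices $u_2,u_2'$ (the merged vertex keeping the name of a vertex of $C_4$ if one of $u_2,u_2'$ lies on $C_4$). If $H^{C_4}$ is decyclizable, i.e. has a proper $4$-colouring $f'$ with $f'(v_2)\neq f'(v_4)$, then $G^{C_4}$ is decyclizable, i.e. there is a proper $4$-colouring $f^*$ of $G^{C_4}$ with $f^*(v_2)\neq f^*(v_4)$.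
   Context: A semi-maximal planar graph (SMPG) $G^C$ is a plane graph whose outer face is bounded by the cycle $C$ (length $\ge4$) and all other faces are triangles. Colours are $\{1,2,3,4\}$; $C_4^0(\cdot)$ denotes proper $4$-colourings up to permutation of colour names; $f(H)=\{f(v):v\in V(H)\}$; a bichromatic cycle of $f$ is a cycle $C$ with $|f(C)|=2$. If $f(C)=\{i,j\}$ and $\{s,t\}$ are the other colours, $\sigma(f,C)$ interchanges $s,t$ on all vertices in the interior of $C$; Kempe-equivalence is generated by $\sigma$-operations and $F^f(\cdot)$ is the Kempe class of $f$. For a $4$-chromatic maximal planar graph $G$ with $\delta(G)\ge4$, a bichromatic cycle $C$ of $f$ is a UB-cycle if $|f'(C)|=2$ for all $f'\in F^f(G)$, and $f$ is then a UBC-colouring with respect to $C$. An SMPG $G^C$ with $|C|=4$ is a $4$-base-module if there is an SMPG $G_1^C$ with $G^C\cap G_1^C=C$ (in the exterior of $C$) such that $G=G^C\cup G_1^C$ is a $4$-chromatic maximal planar graph with $\delta(G)\ge4$ having a UBC-colouring with respect to $C$; a module-colouring of $G^C$ is the restriction to $G^C$ of such a UBC-colouring. $P_{2i}^f(v_2,v_4)$ is the set of paths from $v_2$ to $v_4$ all of whose vertices have colours in $\{2,i\}$ under $f$. A $4$-wheel $W_4=u$-$u_1u_2u_3u_2'u_1$ consists of a vertex $u$ (not on $C_4$) of degree $4$ with neighbours $u_1,u_2,u_3,u_2'$ in cyclic order; it is contractible with respect to $f$ if $|\{u_2,u_2'\}\cap V(C_4)|\le1$ and $f(u_2)=f(u_2')$.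 The contracting $4$-wheel operation deletes $u$, identifies $u_2$ and $u_2'$ into one vertex adjacent to all former neighbours of both, and merges parallel edges. -}

module Defs where

open import Level using (0ℓ)
open import Data.Nat using (ℕ; _≤_; _+_; _*_)
open import Data.Fin using (Fin; zero; suc; _<_)
open import Data.Fin.Properties using (_≟_)
open import Data.Bool using (if_then_else_)
open import Data.Maybe using (just)
open import Data.List using (List; []; _∷_; _++_; take; length; map; deduplicate; head; last)
open import Data.List.Membership.Propositional using (_∈_; _∉_)
open import Data.List.Relation.Unary.All using (All)
open import Data.List.Relation.Unary.Unique.Propositional using (Unique)
open import Data.Product using (Σ; ∃; _×_; _,_)
open import Data.Sum using (_⊎_)
open import Relation.Binary.PropositionalEquality using (_≡_; _≢_)
open import Relation.Nullary using (¬_)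
open import Relation.Nullary.Decidable using (⌊_⌋)
open import Relation.Binary.Construct.Closure.ReflexiveTransitive using (Star)
open import Function.Definitions using (Injective)

-- Colours {1,2,3,4} are Fin 4, colour i being the element (i - 1).

Colour : Set
Colour = Fin 4

col1 col2 col3 col4 : Colour
col1 = zero
col2 = suc zero
col3 = suc (suc zero)
col4 = suc (suc (suc zero))

-- A (facial) triangle is a triple of vertices; the list of facial
-- triangles determines the graph (every edge of an SMPG / maximal planar
-- graph lies on a triangular face).

Tri : ℕ → Set
Tri n = Fin n × Fin n × Fin n

module _ {n : ℕ} where

  _∈ᵗ_ : Fin n → Tri n → Set
  x ∈ᵗ (a , b , c) = x ≡ a ⊎ x ≡ b ⊎ x ≡ c

  SameTri : Tri n → Fin n → Fin n → Fin n → Set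
  SameTri t a b c = ∀ x → (x ∈ᵗ t → x ∈ᵗ (a , b , c)) × (x ∈ᵗ (a , b , c) → x ∈ᵗ t)

  Face : List (Tri n) → Fin n → Fin n → Fin n → Set
  Face T a b c = Σ (Tri n) λ t → t ∈ T × SameTri t a b c

  Adj : List (Tri n) → Fin n → Fin n → Set
  Adj T x y = x ≢ y × Σ (Tri n) λ t → t ∈ T × x ∈ᵗ t × y ∈ᵗ t

  EdgeIn : List (Tri n) → Fin n → Fin n → Tri n → Set
  EdgeIn T x y t = t ∈ T × x ∈ᵗ t × y ∈ᵗ t

  InExactlyOne : List (Tri n) → Fin n → Fin n → Set
  InExactlyOne T x y = Σ (Tri n) λ t → EdgeIn T x y t × (∀ t' → EdgeIn T x y t' → t' ≡ t)

  InExactlyTwo : List (Tri n) → Fin n → Fin n → Set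
  InExactlyTwo T x y = Σ (Tri n) λ t₁ → Σ (Tri n) λ t₂ → t₁ ≢ t₂ × EdgeIn T x y t₁ × EdgeIn T x y t₂
    × (∀ t' → EdgeIn T x y t' → t' ≡ t₁ ⊎ t' ≡ t₂)

  LinkAdj : List (Tri n) → Fin n → Fin n → Fin n → Set
  LinkAdj T v x y = Face T v x y

  Sorted : Tri n → Set
  Sorted (a , b , c) = a < b × b < c

  -- common conditions of a triangulated (pseudo)surface, connected, with
  -- connected vertex links, listing each triangle once (as a sorted triple)
  IsComplex : List (Tri n) → Set
  IsComplex T = All Sorted T × Unique T
    × (∀ x → Σ (Tri n) λ t → t ∈ T × x ∈ᵗ t)
    × (∀ x y → Star (Adj T) x y)
    × (∀ v x y → Adj T v x → Adj T v y → Star (LinkAdj T v) x y)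

data Consec {A : Set} : List A → A → A → Set where
  here  : ∀ {x y xs} → Consec (x ∷ y ∷ xs) x y
  there : ∀ {x xs a b} → Consec xs a b → Consec (x ∷ xs) a b

CycEdge : {A : Set} → List A → A → A → Set
CycEdge xs a b = Consec (xs ++ take 1 xs) a b ⊎ Consec (xs ++ take 1 xs) b a

module _ {n : ℕ} where

  IsCycle : List (Tri n) → List (Fin n) → Set
  IsCycle T cyc = Unique cyc × 3 ≤ length cyc × (∀ x y → CycEdge cyc x y → Adj T x y)

  IsPath : List (Tri n) → List (Fin n) → Fin n → Fin n → Set
  IsPath T xs a b = Unique xs × head xs ≡ just a × last xs ≡ just b
    × (∀ x y → Consec xs x y → Adj T x y)

-- Triangulated sphere = maximal planar graph (with its facial triangles),
-- Euler characteristic 2 (with 2E = 3F this is 2V = F + 4).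

IsMaximalPlanar : (m : ℕ) → List (Tri m) → Set
IsMaximalPlanar m T = IsComplex T
  × (∀ x y → Adj T x y → InExactlyTwo T x y)
  × 2 * m ≡ length T + 4

-- Triangulated disk whose boundary is the cycle C (outer face), all inner
-- faces triangles; Euler characteristic 1 (with 2E = 3F + |C| this is
-- 2V = F + |C| + 2).  With |C| ≥ 4 this is a semi-maximal planar graph G^C.
IsSMPG : (n : ℕ) → List (Tri n) → List (Fin n) → Set
IsSMPG n T C = IsComplex T × Unique C × 4 ≤ length C
  × (∀ x y → CycEdge C x y → Adj T x y)
  × (∀ x y → Adj T x y → (CycEdge C x y → InExactlyOne T x y) × (¬ CycEdge C x y → InExactlyTwo T x y))
  × 2 * n ≡ length T + length C + 2

module _ {m : ℕ} where

  Proper : {k : ℕ} → List (Tri m) → (Fin m → Fin k) → Set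
  Proper T c = ∀ x y → Adj T x y → c x ≢ c y

  NumColours : (Fin m → Colour) → List (Fin m) → ℕ
  NumColours f H = length (deduplicate _≟_ (map f H))

  TriAdj : List (Tri m) → List (Fin m) → Tri m → Tri m → Set
  TriAdj T cyc s t = s ∈ T × t ∈ T × Σ (Fin m) λ x → Σ (Fin m) λ y →
    x ≢ y × x ∈ᵗ s × y ∈ᵗ s × x ∈ᵗ t × y ∈ᵗ t × ¬ CycEdge cyc x y

  OnSide : List (Tri m) → List (Fin m) → Tri m → Fin m → Set
  OnSide T cyc t₀ v = v ∉ cyc × Σ (Tri m) λ t → Star (TriAdj T cyc) t₀ t × v ∈ᵗ t

  -- σ(f, C): C a bichromatic cycle, f(C) = {i,j}; the other two colours are
  -- interchanged on all vertices of one side of C.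
  SigmaStep : List (Tri m) → (Fin m → Colour) → (Fin m → Colour) → Set
  SigmaStep T f f' = Σ (List (Fin m)) λ cyc → IsCycle T cyc × NumColours f cyc ≡ 2
    × Σ (Tri m) λ t₀ → t₀ ∈ T
    × (∀ v → OnSide T cyc t₀ v →
         (f v ∈ map f cyc → f' v ≡ f v)
       × (f v ∉ map f cyc → f' v ∉ map f cyc × f' v ≢ f v))
    × (∀ v → ¬ OnSide T cyc t₀ v → f' v ≡ f v)

  -- renaming of colours (colourings are taken up to permutation of colours)
  PermStep : (Fin m → Colour) → (Fin m → Colour) → Set
  PermStep f f' = Σ (Colour → Colour) λ p → Injective _≡_ _≡_ p × (∀ v → f' v ≡ p (f v))

  KStep : List (Tri m) → (Fin m → Colour) → (Fin m → Colour) → Set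
  KStep T f f' = SigmaStep T f f' ⊎ PermStep f f'

  KempeEquiv : List (Tri m) → (Fin m → Colour) → (Fin m → Colour) → Set
  KempeEquiv T = Star (KStep T)

  IsUBC : List (Tri m) → (Fin m → Colour) → List (Fin m) → Set
  IsUBC T f cyc = Proper T f × IsCycle T cyc × NumColours f cyc ≡ 2
    × (∀ f' → KempeEquiv T f f' → NumColours f' cyc ≡ 2)

  FourChromatic : List (Tri m) → Set
  FourChromatic T = (Σ (Fin m → Fin 4) λ c → Proper T c) × ¬ (Σ (Fin m → Fin 3) λ c → Proper T c)

  MinDegAtLeast4 : List (Tri m) → Set
  MinDegAtLeast4 T = ∀ v → Σ (Fin 4 → Fin m) λ h → Injective _≡_ _≡_ h × (∀ i → Adj T v (h i))

-- A completion of G^C: a maximal planar graph G (vertex set Fin m, faces TG)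
-- together with an embedding ι of G^C into G whose faces are faces of G; the
-- remaining faces form G₁^C, which meets G^C only in C (vertices and edges).

module _ {n : ℕ} where

  SameImg : {m : ℕ} → (Fin n → Fin m) → Tri m → Tri n → Set
  SameImg ι t (a , b , c) = SameTri t (ι a) (ι b) (ι c)

  ImgFace : {m : ℕ} → (Fin n → Fin m) → List (Tri n) → Tri m → Set
  ImgFace ι T t = Σ (Tri n) λ s → s ∈ T × SameImg ι t s


  IsCompletion : (T : List (Tri n)) (C : List (Fin n)) (m : ℕ) (TG : List (Tri m)) (ι : Fin n → Fin m) → Set
  IsCompletion T C m TG ι = IsMaximalPlanar m TG × Injective _≡_ _≡_ ι
    × (∀ a b c → (a , b , c) ∈ T → Face TG (ι a) (ι b) (ι c))
    × (∀ t → t ∈ TG → ¬ ImgFace ι T t → ∀ a → ι a ∈ᵗ t → a ∈ C)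
    × (∀ t → t ∈ TG → ¬ ImgFace ι T t → ∀ a b → ι a ∈ᵗ t → ι b ∈ᵗ t → Adj T a b → CycEdge C a b)

  ModuleColouring : (T : List (Tri n)) (C : List (Fin n)) → (Fin n → Colour) → Set
  ModuleColouring T C f = Σ ℕ λ m → Σ (List (Tri m)) λ TG → Σ (Fin n → Fin m) λ ι →
    IsCompletion T C m TG ι × FourChromatic TG × MinDegAtLeast4 TG
    × Σ (Fin m → Colour) λ g → IsUBC TG g (map ι C) × (∀ a → f a ≡ g (ι a))

  IsBaseModule : (T : List (Tri n)) (C : List (Fin n)) → Set
  IsBaseModule T C = IsSMPG n T C × length C ≡ 4
    × Σ (Fin n → Colour) λ f → ModuleColouring T C f

module _ {n : ℕ} where

  IsContractible4Wheel : List (Tri n) → List (Fin n) → (Fin n → Colour)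
    → (u u₁ u₂ u₃ u₂' : Fin n) → Set
  IsContractible4Wheel T C f u u₁ u₂ u₃ u₂' =
    u ∉ C
    × Unique (u₁ ∷ u₂ ∷ u₃ ∷ u₂' ∷ [])
    × Face T u u₁ u₂ × Face T u u₂ u₃ × Face T u u₃ u₂' × Face T u u₂' u₁
    × (∀ w → Adj T u w → w ≡ u₁ ⊎ w ≡ u₂ ⊎ w ≡ u₃ ⊎ w ≡ u₂')
    × ¬ (u₂ ∈ C × u₂' ∈ C)
    × f u₂ ≡ f u₂'

  merge : (r w : Fin n) → Fin n → Fin n
  merge r w x = if ⌊ x ≟ r ⌋ then w else x

  -- edges of H: images of edges of G^C not incident to u (u deleted, r merged
  -- into w, parallel edges merged)
  HAdj : List (Tri n) → (u r w : Fin n) → Fin n → Fin n → Set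
  HAdj T u r w x' y' = Σ (Fin n) λ x → Σ (Fin n) λ y →
    Adj T x y × x ≢ u × y ≢ u × merge r w x ≡ x' × merge r w y ≡ y'

  -- H (vertex set Fin n ∖ {u, r}) is decyclizable: a proper 4-colouring
  -- (values at the deleted vertices u, r are irrelevant) with f'(v₂) ≠ f'(v₄)
  HDecyclizable : List (Tri n) → (u r w v₂ v₄ : Fin n) → Set
  HDecyclizable T u r w v₂ v₄ = Σ (Fin n → Colour) λ c →
    (∀ x' y' → HAdj T u r w x' y' → c x' ≢ c y') × c v₂ ≢ c v₄

  Decyclizable : List (Tri n) → (v₂ v₄ : Fin n) → Set
  Decyclizable T v₂ v₄ = Σ (Fin n → Colour) λ c → Proper T c × c v₂ ≢ c v₄

{-# OPTIONS --safe #-}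
module Submission where

-- Pull the colouring of H back to G^C along the contraction: every edge of
-- G^C avoiding u is an edge of H, so only u is left uncoloured.  Its four
-- neighbours u₁, u₂, u₃, u₂' all survive, and u₂, u₂' have become one vertex
-- of H, so they carry at most three colours and the fourth one can be given
-- to u.  Neither v₂ nor v₄ is u or the vertex merged away, so f'(v₂) ≠ f'(v₄)
-- survives the pull-back.

open import Defs
open import Data.Nat using (ℕ)
open import Data.Fin using (Fin)
open import Data.Fin.Properties using (_≟_; any?; all?)
open import Data.List using (List; []; _∷_)
open import Data.List.Membership.Propositional using (_∈_; _∉_)
open import Data.List.Relation.Unary.Any using (here; there)
open import Data.List.Relation.Unary.All using (_∷_)
open import Data.List.Relation.Unary.AllPairs using (_∷_)
open import Data.Product using (Σ; _×_; _,_; proj₁; proj₂)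
open import Data.Sum using (_⊎_; inj₁; inj₂)
open import Data.Vec.Functional using (updateAt)
open import Data.Vec.Functional.Properties using (updateAt-updates; updateAt-minimal)
open import Function using (_∘_; const)
open import Relation.Nullary using (yes; no; contradiction)
open import Relation.Nullary.Decidable using (from-yes; ¬?; _×-dec_)
open import Relation.Binary.PropositionalEquality using (_≡_; _≢_; refl; sym; trans; cong)

Avoids₃ : Colour → Colour → Colour → Colour → Set
Avoids₃ a b c d = d ≢ a × d ≢ b × d ≢ c

fourth-colour : (a b c : Colour) → Σ Colour (Avoids₃ a b c)
fourth-colour = from-yes
  (all? λ a → all? λ b → all? λ c → any? {P = Avoids₃ a b c} λ d →
    ¬? (d ≟ a) ×-dec ¬? (d ≟ b) ×-dec ¬? (d ≟ c))

module _ {n : ℕ} where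

  merge-self : (r w : Fin n) → merge r w r ≡ w
  merge-self r w with r ≟ r
  ... | yes _ = refl
  ... | no r≢r = contradiction refl r≢r

  merge-other : (r w x : Fin n) → x ≢ r → merge r w x ≡ x
  merge-other r w x x≢r with x ≟ r
  ... | yes x≡r = contradiction x≡r x≢r
  ... | no _ = refl

  merge-identifies : {r w u₂ u₂' : Fin n} → u₂ ≢ u₂'
    → (w ≡ u₂ × r ≡ u₂') ⊎ (w ≡ u₂' × r ≡ u₂) → merge r w u₂ ≡ merge r w u₂'
  merge-identifies {u₂ = u₂} {u₂'} u₂≢u₂' (inj₁ (refl , refl)) =
    trans (merge-other u₂' u₂ u₂ u₂≢u₂') (sym (merge-self u₂' u₂))
  merge-identifies {u₂ = u₂} {u₂'} u₂≢u₂' (inj₂ (refl , refl)) =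
    trans (merge-self u₂ u₂') (sym (merge-other u₂ u₂' u₂' (u₂≢u₂' ∘ sym)))

  adj-sym : {T : List (Tri n)} {x y : Fin n} → Adj T x y → Adj T y x
  adj-sym (x≢y , t , t∈T , x∈t , y∈t) = x≢y ∘ sym , t , t∈T , y∈t , x∈t

  proper-updateAt : {k : ℕ} (T : List (Tri n)) (g : Fin n → Fin k) (u : Fin n) (d : Fin k)
    → (∀ x y → Adj T x y → x ≢ u → y ≢ u → g x ≢ g y)
    → (∀ y → Adj T u y → d ≢ g y)
    → Proper T (updateAt g u (const d))
  proper-updateAt T g u d g-proper d-fresh x y xy with x ≟ u | y ≟ u
  ... | yes refl | yes refl = contradiction refl (proj₁ xy)
  ... | yes refl | no y≢u = λ e → d-fresh y xy
    (trans (sym (updateAt-updates u g)) (trans e (updateAt-minimal y u g y≢u)))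
  ... | no x≢u | yes refl = λ e → d-fresh x (adj-sym xy)
    (trans (sym (updateAt-updates u g)) (trans (sym e) (updateAt-minimal x u g x≢u)))
  ... | no x≢u | no y≢u = λ e → g-proper x y xy x≢u y≢u
    (trans (sym (updateAt-minimal x u g x≢u)) (trans e (updateAt-minimal y u g y≢u)))

  colour-off-contraction : (c : Fin n → Colour) (u r w : Fin n) (d : Colour) (x : Fin n)
    → x ≢ u → x ≢ r → updateAt (c ∘ merge r w) u (const d) x ≡ c x
  colour-off-contraction c u r w d x x≢u x≢r =
    trans (updateAt-minimal x u (c ∘ merge r w) x≢u) (cong c (merge-other r w x x≢r))

  fresh-colour-at-centre : {T : List (Tri n)} {u u₁ u₂ u₃ u₂' : Fin n} (g : Fin n → Colour)
    → (∀ y → Adj T u y → y ≡ u₁ ⊎ y ≡ u₂ ⊎ y ≡ u₃ ⊎ y ≡ u₂')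
    → g u₂ ≡ g u₂'
    → Σ Colour λ d → ∀ y → Adj T u y → d ≢ g y
  fresh-colour-at-centre {T} {u} {u₁} {u₂} {u₃} {u₂'} g neighbours g₂≡g₂'
    with fourth-colour (g u₁) (g u₂) (g u₃)
  ... | d , d≢g₁ , d≢g₂ , d≢g₃ = d , fresh
    where
    fresh : ∀ y → Adj T u y → d ≢ g y
    fresh y uy with neighbours y uy
    ... | inj₁ refl = d≢g₁
    ... | inj₂ (inj₁ refl) = d≢g₂
    ... | inj₂ (inj₂ (inj₁ refl)) = d≢g₃
    ... | inj₂ (inj₂ (inj₂ refl)) = λ e → d≢g₂ (trans e (sym g₂≡g₂'))

theorem5 : (n : ℕ) (T : List (Tri n)) (v₁ v₂ v₃ v₄ : Fin n)
    → IsSMPG n T (v₁ ∷ v₂ ∷ v₃ ∷ v₄ ∷ [])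
    → IsBaseModule T (v₁ ∷ v₂ ∷ v₃ ∷ v₄ ∷ [])
    → (f : Fin n → Colour)
    → ModuleColouring T (v₁ ∷ v₂ ∷ v₃ ∷ v₄ ∷ []) f
    → f v₁ ≡ col1 → f v₃ ≡ col1 → f v₂ ≡ col2 → f v₄ ≡ col2
    → Σ (List (Fin n)) (λ P → IsPath T P v₂ v₄ × (∀ x → x ∈ P → f x ≡ col2 ⊎ f x ≡ col3))
    → Σ (List (Fin n)) (λ P → IsPath T P v₂ v₄ × (∀ x → x ∈ P → f x ≡ col2 ⊎ f x ≡ col4))
    → (u u₁ u₂ u₃ u₂' : Fin n)
    → IsContractible4Wheel T (v₁ ∷ v₂ ∷ v₃ ∷ v₄ ∷ []) f u u₁ u₂ u₃ u₂'
    → (r w : Fin n)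
    → ((w ≡ u₂ × r ≡ u₂') ⊎ (w ≡ u₂' × r ≡ u₂))
    → r ∉ (v₁ ∷ v₂ ∷ v₃ ∷ v₄ ∷ [])
    → HDecyclizable T u r w v₂ v₄
    → Decyclizable T v₂ v₄
theorem5 n T v₁ v₂ v₃ v₄ _ _ f _ _ _ _ _ _ _ u u₁ u₂ u₃ u₂'
  (u∉C , _ ∷ (_ ∷ u₂≢u₂' ∷ _) ∷ _ , _ , _ , _ , _ , neighbours , _ , _)
  r w r-merged-into-w r∉C (c , c-proper , c₂≢c₄) =
  updateAt g u (const d) , proper-updateAt T g u d g-proper d-fresh , v₂-v₄-differ
  where
  g : Fin n → Colour
  g = c ∘ merge r w

  g-proper : ∀ x y → Adj T x y → x ≢ u → y ≢ u → g x ≢ g y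
  g-proper x y xy x≢u y≢u = c-proper _ _ (x , y , xy , x≢u , y≢u , refl , refl)

  centre : Σ Colour λ d → ∀ y → Adj T u y → d ≢ g y
  centre = fresh-colour-at-centre g neighbours (cong c (merge-identifies u₂≢u₂' r-merged-into-w))

  d : Colour
  d = proj₁ centre

  d-fresh : ∀ y → Adj T u y → d ≢ g y
  d-fresh = proj₂ centre

  v₂-v₄-differ : updateAt g u (const d) v₂ ≢ updateAt g u (const d) v₄
  v₂-v₄-differ e = c₂≢c₄
    (trans (sym (unchanged (there (here refl)))) (trans e (unchanged (there (there (there (here refl)))))))
    where
    unchanged : ∀ {x} → x ∈ v₁ ∷ v₂ ∷ v₃ ∷ v₄ ∷ [] → updateAt g u (const d) x ≡ c x
    unchanged {x} x∈C = colour-off-contraction c u r w d x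
      (λ { refl → u∉C x∈C }) (λ { refl → r∉C x∈C })
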